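{- In each of the Algorithms ODD, EVEN and ODD-COMPRESSED (described in the context), whenever a disk $D_k$ is moved, all smaller disks $D_1,\dots,D_{k-1}$ lie on one and the same peg.
   Context: In all algorithms there are disks $D_1,\dots,D_n$ of increasing size; pegs hold stacks and a moved disk is put on top of the target stack. Algorithm ODD ($m\ge3$ odd): pegs $P_0,\dots,P_{m-1}$ in a row, a step moves a disk to an adjacent peg. Initially all disks on $P_0$. Repeat: move $D_1$ for $m-1$ single steps from whichever of $P_0,P_{m-1}$ it is on to the other; among the topmost disks of the $m-1$ pegs not carrying $D_1$ let $D_k$ be the smallest (terminate if none); move $D_k$ one step — in the only possible direction if it is on $P_0$ or $P_{m-1}$, otherwise in the same direction as its previous move. Algorithm EVEN ($m\ge2$ even): pegs $P_0,\dots,P_m$ in cyclic clockwise order; odd-indexed disks always step clockwise ($P_i\to P_{(i+1)\bmod(m+1)}$), even-indexed disks counterclockwise. Initially all disks on $P_0$. Repeat: move $D_1$ for $m-1$ clockwise steps; among the topmost disks of the $m$ pegs not carrying $D_1$ let $D_k$ be the smallest (terminate if none); move $D_k$ one step in the direction given by the parity of $k$. Algorithm ODD-COMPRESSED ($m\ge3$ odd): pegs $P_0,P_1,P_2$; each disk has a dial cycling through the $2m-2$ states $0,1\!\uparrow,\dots,(m-2)\!\uparrow,m-1,(m-2)\!\downarrow,\dots,1\!\downarrow$; a disk showing $0$ lies on $P_0$, showing $m-1$ on $P_2$, otherwise on $P_1$; turning a disk advances its dial one state and moves it to the corresponding peg if necessary. Initially all disks on $P_0$ showing $0$. Repeat: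 turn $D_1$ $m-1$ times until it reaches $P_0$ or $P_2$; let $D_k$ be the smaller of the topmost disks on the two pegs not carrying $D_1$ (terminate if none); turn $D_k$ once. -}

module Defs where

open import Data.Nat using (ℕ; zero; suc; _+_; _*_; _∸_; _≤_; _<_; _≡ᵇ_; _%_)
open import Data.Bool using (Bool; true; false; if_then_else_; not)
open import Data.List using (List; []; _∷_; _++_; map; upTo; filterᵇ; head)
open import Data.List.Membership.Propositional using (_∈_)
open import Data.List.Membership.DecPropositional Data.Nat._≟_ using (_∈?_)
open import Data.Maybe using (Maybe; just; nothing; _>>=_)
open import Data.Product using (_×_; _,_; proj₁; proj₂; ∃)
open import Relation.Nullary using (yes; no)

-- Disks are the natural numbers 1..n (D_k is the number k).
-- Pegs are natural numbers 0..(#pegs - 1).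
-- A configuration of stacks assigns to each peg the list of disks on it,
-- TOPMOST DISK FIRST.

Stacks : Set
Stacks = ℕ → List ℕ

initStacks : ℕ → Stacks
initStacks n zero    = map suc (upTo n)
initStacks n (suc _) = []

moveTo : ℕ → ℕ → Stacks → Stacks
moveTo k t s p =
  if p ≡ᵇ t then k ∷ filterᵇ (λ d → not (d ≡ᵇ k)) (s p)
            else filterᵇ (λ d → not (d ≡ᵇ k)) (s p)

-- the peg (among the listed pegs) carrying disk k (first match; 0 if none)
findIn : Stacks → List ℕ → ℕ → ℕ
findIn s []       k = 0
findIn s (p ∷ ps) k with k ∈? s p
... | yes _ = p
... | no  _ = findIn s ps k

pegOf : Stacks → ℕ → ℕ → ℕ
pegOf s c k = findIn s (upTo c) k

minM : Maybe ℕ → Maybe ℕ → Maybe ℕ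
minM nothing  y        = y
minM (just x) nothing  = just x
minM (just x) (just y) = just (Data.Nat._⊓_ x y)

smallestTop : Stacks → List ℕ → Maybe ℕ
smallestTop s []       = nothing
smallestTop s (p ∷ ps) = minM (head (s p)) (smallestTop s ps)

otherPegs : ℕ → List ℕ → List ℕ
otherPegs c ps = filterᵇ (λ p → not (p ≡ᵇ c)) ps

-- A move event: the disk moved, together with the stacks at the moment
-- it is moved (just before the move).
Event : Set
Event = ℕ × Stacks

iterMoves : {S : Set} → (S → Stacks) → ℕ → ℕ → (S → S) → S → List Event × S
iterMoves st d zero    f x = [] , x
iterMoves st d (suc j) f x with iterMoves st d j f (f x)
... | es , y = (d , st x) ∷ es , y

-- Running an algorithm given by an initial state and a round function.
-- A round returns the list of moves it makes and the next state
-- (nothing = the algorithm terminated in this round).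
stateAfter : {S : Set} → S → (S → List Event × Maybe S) → ℕ → Maybe S
stateAfter i rnd zero    = just i
stateAfter i rnd (suc r) = stateAfter i rnd r >>= λ x → proj₂ (rnd x)

SmallerOnOnePeg : Stacks → ℕ → Set
SmallerOnOnePeg s k = ∃ λ p → ∀ i → 1 ≤ i → i < k → i ∈ s p

GoodRun : {S : Set} → S → (S → List Event × Maybe S) → Set
GoodRun i rnd = ∀ r x → stateAfter i rnd r ≡ just x →
  ∀ k t → (k , t) ∈ proj₁ (rnd x) → SmallerOnOnePeg t k
  where open import Relation.Binary.PropositionalEquality using (_≡_)

-- Algorithm ODD (m odd, pegs P_0..P_{m-1} in a row).
-- State: stacks, and for each disk the direction of its previous move
-- (true = towards higher indices).

OddState : Set
OddState = Stacks × (ℕ → Bool)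

oddInit : ℕ → OddState
oddInit n = initStacks n , λ _ → true

oddStepDir : ℕ → ℕ → Bool → OddState → OddState
oddStepDir m k u (s , dir) =
  let c = pegOf s m k in
  moveTo k (if u then suc c else c ∸ 1) s ,
  (λ d → if d ≡ᵇ k then u else dir d)

oddStep : ℕ → ℕ → OddState → OddState
oddStep m k (s , dir) =
  let c = pegOf s m k in
  oddStepDir m k (if c ≡ᵇ 0 then true else if c ≡ᵇ (m ∸ 1) then false else dir k) (s , dir)

oddRound : ℕ → OddState → List Event × Maybe OddState
oddRound m x with
  iterMoves proj₁ 1 (m ∸ 1) (oddStepDir m 1 (pegOf (proj₁ x) m 1 ≡ᵇ 0)) x
... | es , y with smallestTop (proj₁ y) (otherPegs (pegOf (proj₁ y) m 1) (upTo m))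
...   | nothing = es , nothing
...   | just k  = es ++ ((k , proj₁ y) ∷ []) , just (oddStep m k y)

-- Algorithm EVEN (m even, pegs P_0..P_m in a cycle). State: stacks.

cw : ℕ → ℕ → ℕ
cw m c = suc c % suc m

ccw : ℕ → ℕ → ℕ
ccw m c = (c + m) % suc m

isOdd : ℕ → Bool
isOdd k = k % 2 ≡ᵇ 1

evenStep : ℕ → ℕ → Stacks → Stacks
evenStep m k s =
  let c = pegOf s (suc m) k in
  moveTo k (if isOdd k then cw m c else ccw m c) s

evenRound : ℕ → Stacks → List Event × Maybe Stacks
evenRound m x with iterMoves (λ s → s) 1 (m ∸ 1) (evenStep m 1) x
... | es , y with smallestTop y (otherPegs (pegOf y (suc m) 1) (upTo (suc m)))
...   | nothing = es , nothing
...   | just k  = es ++ ((k , y) ∷ []) , just (evenStep m k y)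

-- Dial states are encoded by j ∈ {0,...,2m-3}:
--   j = 0 ↦ 0,  1 ≤ j ≤ m-2 ↦ j↑,  j = m-1 ↦ m-1,  m ≤ j ≤ 2m-3 ↦ (2m-2-j)↓,
-- so advancing the dial is j ↦ j+1 mod (2m-2).

CompState : Set
CompState = Stacks × (ℕ → ℕ)

compInit : ℕ → CompState
compInit n = initStacks n , λ _ → 0

dialNext : ℕ → ℕ → ℕ
dialNext m j = if suc j ≡ᵇ (2 * m ∸ 2) then 0 else suc j

dialPeg : ℕ → ℕ → ℕ
dialPeg m j = if j ≡ᵇ 0 then 0 else if j ≡ᵇ (m ∸ 1) then 2 else 1

turn : ℕ → ℕ → CompState → CompState
turn m k (s , dial) =
  let j' = dialNext m (dial k)
      t  = dialPeg m j' in
  (if pegOf s 3 k ≡ᵇ t then s else moveTo k t s) ,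
  (λ d → if d ≡ᵇ k then j' else dial d)

compRound : ℕ → CompState → List Event × Maybe CompState
compRound m x with iterMoves proj₁ 1 (m ∸ 1) (turn m 1) x
... | es , y with smallestTop (proj₁ y) (otherPegs (pegOf (proj₁ y) 3 1) (upTo 3))
...   | nothing = es , nothing
...   | just k  = es ++ ((k , proj₁ y) ∷ []) , just (turn m k y)

module Submission where

-- A round of each algorithm has the same shape: D_1 makes m-1 moves,
-- then the smallest top disk D_k on the pegs not carrying D_1 is moved.  As
-- long as every move is legal (no disk is put on a smaller one), the stacks
-- are sorted, so each disk smaller than D_k lies on the peg of D_1: on any
-- other peg it would give a top disk smaller than D_k.  The theorem thus
-- reduces to the legality of the chosen moves.  For this, a configuration
-- encodes a counter with one digit per disk; a round adds one to it (D_1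
-- runs through its digit, the move of D_k is the carry), and the carry never
-- sends D_k onto the peg of D_1.  For ODD and ODD-COMPRESSED the counter is
-- a reflected (Gray code) mixed-radix counter whose digits, read in their
-- directions, are the pegs of ODD; for EVEN consecutive disks are linked by
-- a congruence modulo m+1.

open import Defs
open import Data.Nat using (ℕ; zero; suc; _+_; _*_; _∸_; _≤_; _<_; _≡ᵇ_; _<ᵇ_; _⊓_; _%_; _≟_; z≤n; s≤s)
open import Data.Nat.DivMod using (%-distribˡ-+; m%n%n≡m%n; [m+n]%n≡m%n; m<n⇒m%n≡m; m%n<n)
open import Data.Nat.Tactic.RingSolver using (solve-∀)
open import Data.Nat.Properties
open import Data.Bool using (Bool; true; false; if_then_else_; not; T; T?; _xor_)
open import Data.Bool.Properties using (xor-identityʳ; not-distribʳ-xor; not-involutive)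
open import Data.List using (List; []; _∷_; _++_; upTo; filterᵇ; head)
open import Data.List.Properties using (map-upTo)
open import Data.List.Membership.Propositional using (_∈_)
open import Data.List.Membership.Propositional.Properties
  using (∈-filter⁺; ∈-filter⁻; ∈-map⁺; ∈-map⁻; ∈-upTo⁺; ∈-upTo⁻; ∈-++⁻)
open import Data.List.Membership.DecPropositional Data.Nat._≟_ using (_∈?_)
open import Data.List.Relation.Unary.Any using (here; there)
open import Data.List.Relation.Unary.All using (All; lookup; tabulate)
open import Data.List.Relation.Unary.AllPairs using (AllPairs; []; _∷_)
import Data.List.Relation.Unary.AllPairs.Properties as AllPairs
open import Data.Maybe using (Maybe; just; nothing)
open import Data.Maybe.Properties using (just-injective)
open import Data.Product using (Σ; _×_; _,_; proj₁; proj₂; ∃)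
open import Data.Sum using (_⊎_; inj₁; inj₂)
open import Data.Empty using (⊥; ⊥-elim)
open import Relation.Nullary using (yes; no; ¬_)
open import Relation.Binary.Definitions using (tri<; tri≈; tri>)
open import Relation.Binary.PropositionalEquality
open import Relation.Binary.Bundles using (Setoid)
open import Function using (_∘_)

≡ᵇ-refl : ∀ n → (n ≡ᵇ n) ≡ true
≡ᵇ-refl zero    = refl
≡ᵇ-refl (suc n) = ≡ᵇ-refl n

≡ᵇ-≢ : ∀ {m n} → m ≢ n → (m ≡ᵇ n) ≡ false
≡ᵇ-≢ {m} {n} m≢n with m ≡ᵇ n in eq
... | true  = ⊥-elim (m≢n (≡ᵇ⇒≡ m n (subst T (sym eq) _)))
... | false = refl

≡ᵇ-sound : ∀ {m n} → (m ≡ᵇ n) ≡ true → m ≡ n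
≡ᵇ-sound {m} {n} eq = ≡ᵇ⇒≡ m n (subst T (sym eq) _)

<ᵇ-yes : ∀ {m n} → m < n → (m <ᵇ n) ≡ true
<ᵇ-yes {m} {n} m<n with m <ᵇ n | <⇒<ᵇ m<n
... | true | _ = refl

<ᵇ-no : ∀ {m n} → ¬ (m < n) → (m <ᵇ n) ≡ false
<ᵇ-no {m} {n} m≮n with m <ᵇ n in eq
... | true  = ⊥-elim (m≮n (<ᵇ⇒< m n (subst T (sym eq) _)))
... | false = refl

true≢false : true ≢ false
true≢false ()

≥2⇒≢1 : ∀ {d} → 2 ≤ d → d ≢ 1
≥2⇒≢1 (s≤s ()) refl

upd : {A : Set} → (ℕ → A) → ℕ → A → ℕ → A
upd f k v d = if d ≡ᵇ k then v else f d

upd-same : ∀ {A : Set} (f : ℕ → A) k v → upd f k v k ≡ v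
upd-same f k v rewrite ≡ᵇ-refl k = refl

upd-other : ∀ {A : Set} (f : ℕ → A) k v {d} → d ≢ k → upd f k v d ≡ f d
upd-other f k v d≢k rewrite ≡ᵇ-≢ d≢k = refl

upd-agrees : ∀ {A : Set} (f g : ℕ → A) k v → v ≡ g k → (∀ d → d ≢ k → f d ≡ g d) →
  ∀ d → upd f k v d ≡ g d
upd-agrees f g k v at away d with d ≟ k
... | yes refl = trans (upd-same f d v) at
... | no d≢k   = trans (upd-other f k v d≢k) (away d d≢k)

remove : ℕ → List ℕ → List ℕ
remove k = filterᵇ (λ d → not (d ≡ᵇ k))

∈-remove⁻ : ∀ {k d l} → d ∈ remove k l → d ∈ l × d ≢ k
∈-remove⁻ {k} {d} {l} d∈ with ∈-filter⁻ (λ x → T? (not (x ≡ᵇ k))) {xs = l} d∈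
... | d∈l , T≢ = d∈l , λ { refl → subst (λ b → T (not b)) (≡ᵇ-refl d) T≢ }

∈-remove⁺ : ∀ {k d l} → d ∈ l → d ≢ k → d ∈ remove k l
∈-remove⁺ {k} {d} d∈l d≢k =
  ∈-filter⁺ (λ x → T? (not (x ≡ᵇ k))) d∈l (subst (λ b → T (not b)) (sym (≡ᵇ-≢ d≢k)) _)

moveTo-target : ∀ k t s → moveTo k t s t ≡ k ∷ remove k (s t)
moveTo-target k t s rewrite ≡ᵇ-refl t = refl

moveTo-other : ∀ k t s {p} → p ≢ t → moveTo k t s p ≡ remove k (s p)
moveTo-other k t s p≢t rewrite ≡ᵇ-≢ p≢t = refl

remove-sorted : ∀ k {l} → AllPairs _<_ l → AllPairs _<_ (remove k l)
remove-sorted k = AllPairs.filter⁺ (λ x → T? (not (x ≡ᵇ k)))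

∈-moveTo⁻ : ∀ {k t s p d} → d ∈ moveTo k t s p → (d ≡ k × p ≡ t) ⊎ (d ∈ s p × d ≢ k)
∈-moveTo⁻ {k} {t} {s} {p} d∈ with p ≟ t
... | no p≢t = inj₂ (∈-remove⁻ (subst (_ ∈_) (moveTo-other k t s p≢t) d∈))
... | yes refl with subst (_ ∈_) (moveTo-target k t s) d∈
...   | here d≡k = inj₁ (d≡k , refl)
...   | there d∈′ = inj₂ (∈-remove⁻ d∈′)

∈-moveTo⁺ : ∀ {k t s p d} → d ∈ s p → d ≢ k → d ∈ moveTo k t s p
∈-moveTo⁺ {k} {t} {s} {p} d∈ d≢k with p ≟ t
... | no p≢t   = subst (_ ∈_) (sym (moveTo-other k t s p≢t)) (∈-remove⁺ d∈ d≢k)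
... | yes refl = subst (_ ∈_) (sym (moveTo-target k t s)) (there (∈-remove⁺ d∈ d≢k))

-- This is the
-- "only legal moves were made" invariant behind all three algorithms.
record Layout (n : ℕ) (pos : ℕ → ℕ) (s : Stacks) : Set where
  field
    sorted   : ∀ p → AllPairs _<_ (s p)
    sound    : ∀ {p d} → d ∈ s p → (1 ≤ d × d ≤ n) × pos d ≡ p
    complete : ∀ {d} → 1 ≤ d → d ≤ n → d ∈ s (pos d)

layout-init : ∀ n → Layout n (λ _ → 0) (initStacks n)
layout-init n = record { sorted = sorted ; sound = sound ; complete = complete }
  where
    sorted : ∀ p → AllPairs _<_ (initStacks n p)
    sorted zero rewrite map-upTo suc n = AllPairs.applyUpTo⁺₁ suc n (λ i<j _ → s≤s i<j)
    sorted (suc p) = []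
    sound : ∀ {p d} → d ∈ initStacks n p → (1 ≤ d × d ≤ n) × 0 ≡ p
    sound {zero} d∈ with ∈-map⁻ suc d∈
    ... | i , i∈ , refl = (s≤s z≤n , ∈-upTo⁻ i∈) , refl
    complete : ∀ {d} → 1 ≤ d → d ≤ n → d ∈ initStacks n 0
    complete {suc d} _ d<n = ∈-map⁺ suc (∈-upTo⁺ d<n)

layout-ext : ∀ {n pos pos′ s} → Layout n pos s →
  (∀ d → 1 ≤ d → d ≤ n → pos d ≡ pos′ d) → Layout n pos′ s
layout-ext {n} {pos} {pos′} {s} L same = record
  { sorted = sorted ; sound = sound′ ; complete = complete′ }
  where
    open Layout L
    sound′ : ∀ {p d} → d ∈ s p → (1 ≤ d × d ≤ n) × pos′ d ≡ p
    sound′ d∈ with sound d∈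
    ... | (1≤d , d≤n) , pd = (1≤d , d≤n) , trans (sym (same _ 1≤d d≤n)) pd
    complete′ : ∀ {d} → 1 ≤ d → d ≤ n → d ∈ s (pos′ d)
    complete′ {d} 1≤d d≤n = subst (λ p → d ∈ s p) (same d 1≤d d≤n) (complete 1≤d d≤n)

layout-move : ∀ {n pos s k t} → Layout n pos s → 1 ≤ k → k ≤ n →
  (∀ d → 1 ≤ d → d < k → pos d ≢ t) → Layout n (upd pos k t) (moveTo k t s)
layout-move {n} {pos} {s} {k} {t} L 1≤k k≤n legal = record
  { sorted = sorted′ ; sound = sound′ ; complete = complete′ }
  where
    open Layout L
    above : All (k <_) (remove k (s t))
    above = tabulate λ {d} d∈ →
      let d∈s , d≢k = ∈-remove⁻ d∈
          (1≤d , _) , pd = sound d∈s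
      in ≤∧≢⇒< (≮⇒≥ (λ d<k → legal d 1≤d d<k pd)) (λ k≡d → d≢k (sym k≡d))
    sorted′ : ∀ p → AllPairs _<_ (moveTo k t s p)
    sorted′ p with p ≟ t
    ... | yes refl = subst (AllPairs _<_) (sym (moveTo-target k t s)) (above ∷ remove-sorted k (sorted t))
    ... | no p≢t   = subst (AllPairs _<_) (sym (moveTo-other k t s p≢t)) (remove-sorted k (sorted p))
    sound′ : ∀ {p d} → d ∈ moveTo k t s p → (1 ≤ d × d ≤ n) × upd pos k t d ≡ p
    sound′ d∈ with ∈-moveTo⁻ {k} {t} {s} d∈
    ... | inj₁ (refl , refl) = (1≤k , k≤n) , upd-same pos k t
    ... | inj₂ (d∈s , d≢k) with sound d∈s
    ...   | bounds , pd = bounds , trans (upd-other pos k t d≢k) pd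
    complete′ : ∀ {d} → 1 ≤ d → d ≤ n → d ∈ moveTo k t s (upd pos k t d)
    complete′ {d} 1≤d d≤n with d ≟ k
    ... | yes refl = subst (λ p → d ∈ moveTo d t s p) (sym (upd-same pos d t))
                       (subst (d ∈_) (sym (moveTo-target d t s)) (here refl))
    ... | no d≢k = subst (λ p → d ∈ moveTo k t s p) (sym (upd-other pos k t d≢k))
                     (∈-moveTo⁺ {k} {t} {s} (complete 1≤d d≤n) d≢k)

findIn-unique : ∀ s ps k p → p ∈ ps → k ∈ s p → (∀ q → k ∈ s q → q ≡ p) → findIn s ps k ≡ p
findIn-unique s (q ∷ ps) k p p∈ k∈p unique with k ∈? s q
... | yes k∈q = unique q k∈q
findIn-unique s (q ∷ ps) k p (here refl) k∈p unique | no k∉q = ⊥-elim (k∉q k∈p)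
findIn-unique s (q ∷ ps) k p (there p∈) k∈p unique | no k∉q = findIn-unique s ps k p p∈ k∈p unique

pegOf-layout : ∀ {n pos s c k} → Layout n pos s → 1 ≤ k → k ≤ n → pos k < c → pegOf s c k ≡ pos k
pegOf-layout {s = s} {c} {k} L 1≤k k≤n pk<c =
  findIn-unique s (upTo c) k _ (∈-upTo⁺ pk<c) (complete 1≤k k≤n) (λ q k∈q → sym (proj₂ (sound k∈q)))
  where open Layout L

top-least : ∀ {l d} → AllPairs _<_ l → d ∈ l → ∃ λ h → head l ≡ just h × h ≤ d
top-least (_ ∷ _)     (here refl) = _ , refl , ≤-refl
top-least (x<xs ∷ _) (there d∈)  = _ , refl , <⇒≤ (lookup x<xs d∈)

head-member : ∀ (l : List ℕ) {x} → head l ≡ just x → x ∈ l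
head-member (_ ∷ _) refl = here refl

smallestTop-top : ∀ s ps {k} → smallestTop s ps ≡ just k → ∃ λ p → p ∈ ps × head (s p) ≡ just k
smallestTop-top s (p ∷ ps) {k} eq with head (s p) in hp | smallestTop s ps in rest
... | nothing | just _ with refl ← eq = later (smallestTop-top s ps rest) refl
  where
    later : ∀ {y} → (∃ λ q → q ∈ ps × head (s q) ≡ just y) → y ≡ k →
      ∃ λ q → q ∈ p ∷ ps × head (s q) ≡ just k
    later (q , q∈ , hq) refl = q , there q∈ , hq
... | just _ | nothing with refl ← eq = p , here refl , hp
... | just x | just y with ⊓-sel x y
...   | inj₁ x⊓y≡x = p , here refl , trans hp (cong just (trans (sym x⊓y≡x) (just-injective eq)))
...   | inj₂ x⊓y≡y with smallestTop-top s ps rest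
...     | q , q∈ , hq = q , there q∈ , trans hq (cong just (trans (sym x⊓y≡y) (just-injective eq)))

smallestTop-least : ∀ s ps {q h} → q ∈ ps → head (s q) ≡ just h →
  ∃ λ k → smallestTop s ps ≡ just k × k ≤ h
smallestTop-least s (p ∷ ps) {h = h} (here refl) hq rewrite hq with smallestTop s ps
... | nothing = h , refl , ≤-refl
... | just y  = h ⊓ y , refl , m⊓n≤m h y
smallestTop-least s (p ∷ ps) (there q∈) hq with smallestTop-least s ps q∈ hq
... | y , rest , y≤h rewrite rest with head (s p)
...   | nothing = y , refl , y≤h
...   | just x  = x ⊓ y , refl , ≤-trans (m⊓n≤n x y) y≤h

record Chosen (n : ℕ) (pos : ℕ → ℕ) (p k : ℕ) : Set where
  field
    1≤k          : 1 ≤ k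
    k≤n          : k ≤ n
    not-on-p     : pos k ≢ p
    smaller-on-p : ∀ d → 1 ≤ d → d < k → pos d ≡ p

chosen : ∀ {n pos s c p k} → Layout n pos s → (∀ d → 1 ≤ d → d ≤ n → pos d < c) →
  smallestTop s (otherPegs p (upTo c)) ≡ just k → Chosen n pos p k
chosen {n} {pos} {s} {c} {p} {k} L on-board eq with smallestTop-top s (otherPegs p (upTo c)) eq
... | q , q∈ , hq = record
  { 1≤k = 1≤k ; k≤n = k≤n
  ; not-on-p = λ pk≡p → proj₂ (∈-remove⁻ {l = upTo c} q∈) (trans (sym pkq) pk≡p)
  ; smaller-on-p = smaller }
  where
    open Layout L
    k-info = sound (head-member (s q) hq)
    1≤k = proj₁ (proj₁ k-info)
    k≤n = proj₂ (proj₁ k-info)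
    pkq = proj₂ k-info
    -- D_k is at most every disk off peg p, since it is at most that peg's top.
    least-off-p : ∀ d → 1 ≤ d → d ≤ n → pos d ≢ p → k ≤ d
    least-off-p d 1≤d d≤n pd≢p with top-least (sorted (pos d)) (complete 1≤d d≤n)
    ... | h , hd , h≤d
      with smallestTop-least s (otherPegs p (upTo c))
             (∈-remove⁺ {l = upTo c} (∈-upTo⁺ (on-board d 1≤d d≤n)) pd≢p) hd
    ...   | k′ , eq′ , k′≤h = subst (_≤ d) (just-injective (trans (sym eq′) eq)) (≤-trans k′≤h h≤d)
    smaller : ∀ d → 1 ≤ d → d < k → pos d ≡ p
    smaller d 1≤d d<k with pos d ≟ p
    ... | yes pd≡p = pd≡p
    ... | no pd≢p  = ⊥-elim (<⇒≱ d<k (least-off-p d 1≤d (≤-trans (<⇒≤ d<k) k≤n) pd≢p))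

chosen-in-round : ∀ {n pos s c k} → Layout n pos s → 1 ≤ n → (∀ d → 1 ≤ d → d ≤ n → pos d < c) →
  smallestTop s (otherPegs (pegOf s c 1) (upTo c)) ≡ just k → Chosen n pos (pos 1) k
chosen-in-round {s = s} {c} {k} L 1≤n on-board eq = chosen L on-board
  (subst (λ p → smallestTop s (otherPegs p (upTo c)) ≡ just k)
    (pegOf-layout L ≤-refl 1≤n (on-board 1 ≤-refl 1≤n)) eq)

chosen-good : ∀ {n pos s p k} → Layout n pos s → Chosen n pos p k → SmallerOnOnePeg s k
chosen-good {s = s} {p} L C = p , λ i 1≤i i<k →
  subst (λ q → i ∈ s q) (smaller-on-p i 1≤i i<k) (complete 1≤i (≤-trans (<⇒≤ i<k) k≤n))
  where open Layout L
        open Chosen C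

nothing-below-1 : ∀ {d} → 1 ≤ d → d < 1 → ⊥
nothing-below-1 1≤d d<1 = <⇒≱ d<1 1≤d

good-disk1 : ∀ s → SmallerOnOnePeg s 1
good-disk1 s = 0 , λ i 1≤i i<1 → ⊥-elim (nothing-below-1 1≤i i<1)

iterN : {S : Set} → ℕ → (S → S) → S → S
iterN zero    f x = x
iterN (suc j) f x = iterN j f (f x)

iterMoves-final : ∀ {S : Set} (st : S → Stacks) d j f x → proj₂ (iterMoves st d j f x) ≡ iterN j f x
iterMoves-final st d zero    f x = refl
iterMoves-final st d (suc j) f x with iterMoves st d j f (f x) in eq
... | _ , _ = trans (cong proj₂ (sym eq)) (iterMoves-final st d j f (f x))

iterMoves-disk : ∀ {S : Set} (st : S → Stacks) d j f x {k t} → (k , t) ∈ proj₁ (iterMoves st d j f x) → k ≡ d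
iterMoves-disk st d (suc j) f x ev with iterMoves st d j f (f x) in eq
iterMoves-disk st d (suc j) f x (here refl) | _ , _ = refl
iterMoves-disk st d (suc j) f x (there ev)  | _ , _ =
  iterMoves-disk st d j f (f x) (subst (λ r → _ ∈ proj₁ r) (sym eq) ev)

twoPhase : {S : Set} (st : S → Stacks) (c j : ℕ) (f : S → S → S) (g : ℕ → S → S) →
  S → List Event × Maybe S
twoPhase st c j f g x with iterMoves st 1 j (f x) x
... | es , y with smallestTop (st y) (otherPegs (pegOf (st y) c 1) (upTo c))
...   | nothing = es , nothing
...   | just k  = es ++ ((k , st y) ∷ []) , just (g k y)

oddRound-shape : ∀ m x → oddRound m x ≡
  twoPhase proj₁ m (m ∸ 1) (λ x → oddStepDir m 1 (pegOf (proj₁ x) m 1 ≡ᵇ 0)) (oddStep m) x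
oddRound-shape m x with iterMoves proj₁ 1 (m ∸ 1) (oddStepDir m 1 (pegOf (proj₁ x) m 1 ≡ᵇ 0)) x
... | es , y with smallestTop (proj₁ y) (otherPegs (pegOf (proj₁ y) m 1) (upTo m))
...   | nothing = refl
...   | just k  = refl

compRound-shape : ∀ m x → compRound m x ≡ twoPhase proj₁ 3 (m ∸ 1) (λ _ → turn m 1) (turn m) x
compRound-shape m x with iterMoves proj₁ 1 (m ∸ 1) (turn m 1) x
... | es , y with smallestTop (proj₁ y) (otherPegs (pegOf (proj₁ y) 3 1) (upTo 3))
...   | nothing = refl
...   | just k  = refl

evenRound-shape : ∀ m x →
  evenRound m x ≡ twoPhase (λ s → s) (suc m) (m ∸ 1) (λ _ → evenStep m 1) (evenStep m) x
evenRound-shape m x with iterMoves (λ s → s) 1 (m ∸ 1) (evenStep m 1) x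
... | es , y with smallestTop y (otherPegs (pegOf y (suc m) 1) (upTo (suc m)))
...   | nothing = refl
...   | just k  = refl

goodRun-cong : ∀ {S : Set} {i : S} {rnd rnd′ : S → List Event × Maybe S} →
  (∀ x → rnd x ≡ rnd′ x) → GoodRun i rnd′ → GoodRun i rnd
goodRun-cong {S} {i} {rnd} {rnd′} same good r x reached k t ev =
  good r x (trans (sym (states r)) reached) k t (subst (λ z → (k , t) ∈ proj₁ z) (same x) ev)
  where
    states : ∀ r → stateAfter i rnd r ≡ stateAfter i rnd′ r
    states zero = refl
    states (suc r) rewrite states r with stateAfter i rnd′ r
    ... | nothing = refl
    ... | just z  = cong proj₂ (same z)

twoPhase-good : ∀ {S : Set} (st : S → Stacks) c j f g (Start Mid : S → Set) →
  (∀ x → Start x → Mid (iterN j (f x) x)) →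
  (∀ y k → Mid y → smallestTop (st y) (otherPegs (pegOf (st y) c 1) (upTo c)) ≡ just k →
     SmallerOnOnePeg (st y) k × Start (g k y)) →
  ∀ i → Start i → GoodRun i (twoPhase st c j f g)
twoPhase-good {S} st c j f g Start Mid tour step i start r x reached =
  round x (reachable r x reached)
  where
    reachable : ∀ r x → stateAfter i (twoPhase st c j f g) r ≡ just x → Start x
    next : ∀ x → Start x → ∀ y → proj₂ (twoPhase st c j f g x) ≡ just y → Start y
    round : ∀ x → Start x → ∀ k t → (k , t) ∈ proj₁ (twoPhase st c j f g x) → SmallerOnOnePeg t k

    reachable zero    x refl = start
    reachable (suc r) x eq with stateAfter i (twoPhase st c j f g) r in eq′
    ... | just z = next z (reachable r z eq′) x eq

    mid : ∀ x es y → Start x → iterMoves st 1 j (f x) x ≡ (es , y) → Mid y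
    mid x es y s eq = subst Mid (trans (sym (iterMoves-final st 1 j (f x) x)) (cong proj₂ eq)) (tour x s)

    disk1 : ∀ x es y → iterMoves st 1 j (f x) x ≡ (es , y) → ∀ {k t} → (k , t) ∈ es → SmallerOnOnePeg t k
    disk1 x es y eq ev with iterMoves-disk st 1 j (f x) x (subst (λ r → _ ∈ proj₁ r) (sym eq) ev)
    ... | refl = good-disk1 _

    next x s y′ eq with iterMoves st 1 j (f x) x in eq₁
    ... | es , y with smallestTop (st y) (otherPegs (pegOf (st y) c 1) (upTo c)) in eq₂
    next x s y′ refl | es , y | just k = proj₂ (step y k (mid x es y s eq₁) eq₂)

    round x s k t ev with iterMoves st 1 j (f x) x in eq₁
    ... | es , y with smallestTop (st y) (otherPegs (pegOf (st y) c 1) (upTo c)) in eq₂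
    ...   | nothing = disk1 x es y eq₁ ev
    ...   | just k′ with ∈-++⁻ es ev
    ...     | inj₁ ev′ = disk1 x es y eq₁ ev′
    ...     | inj₂ (here refl) = proj₁ (step y k′ (mid x es y s eq₁) eq₂)

iterN-preserves : ∀ {S : Set} (P : S → Set) (f : S → S) → (∀ x → P x → P (f x)) →
  ∀ j x → P x → P (iterN j f x)
iterN-preserves P f keep zero    x p = p
iterN-preserves P f keep (suc j) x p = iterN-preserves P f keep j (f x) (keep x p)

iterN-climb : ∀ {S : Set} (P : ℕ → S → Set) (f : S → S) top →
  (∀ a x → a < top → P a x → P (suc a) (f x)) →
  ∀ j a x → a + j ≤ top → P a x → P (a + j) (iterN j f x)
iterN-climb P f top up zero    a x _ p = subst (λ b → P b x) (sym (+-identityʳ a)) p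
iterN-climb P f top up (suc j) a x a+j≤top p =
  subst (λ b → P b (iterN j f (f x))) (sym (+-suc a j))
    (iterN-climb P f top up j (suc a) (f x) (subst (_≤ top) (+-suc a j) a+j≤top)
      (up a x (≤-trans (s≤s (m≤m+n a j)) (subst (_≤ top) (+-suc a j) a+j≤top)) p))

-- The degenerate case n = 0: then D_1 is the only disk that ever appears
-- (moveTo creates it), so every move is a move of D_1.
OnlyDisk1 : Stacks → Set
OnlyDisk1 s = ∀ p d → d ∈ s p → d ≡ 1

onlyDisk1-init : OnlyDisk1 (initStacks 0)
onlyDisk1-init zero    d ()
onlyDisk1-init (suc p) d ()

onlyDisk1-move : ∀ {s} t → OnlyDisk1 s → OnlyDisk1 (moveTo 1 t s)
onlyDisk1-move {s} t only p d d∈ with ∈-moveTo⁻ {1} {t} {s} d∈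
... | inj₁ (d≡1 , _)   = d≡1
... | inj₂ (d∈s , _) = only p d d∈s

twoPhase-onlyDisk1 : ∀ {S : Set} (st : S → Stacks) c j f g →
  (∀ x y → OnlyDisk1 (st y) → OnlyDisk1 (st (f x y))) →
  (∀ y → OnlyDisk1 (st y) → OnlyDisk1 (st (g 1 y))) →
  ∀ i → OnlyDisk1 (st i) → GoodRun i (twoPhase st c j f g)
twoPhase-onlyDisk1 st c j f g keep₁ keep₂ =
  twoPhase-good st c j f g (OnlyDisk1 ∘ st) (OnlyDisk1 ∘ st)
    (λ x → iterN-preserves (OnlyDisk1 ∘ st) (f x) (keep₁ x) j x) step
  where
    step : ∀ y k → OnlyDisk1 (st y) → smallestTop (st y) (otherPegs (pegOf (st y) c 1) (upTo c)) ≡ just k →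
      SmallerOnOnePeg (st y) k × OnlyDisk1 (st (g k y))
    step y k only eq with smallestTop-top (st y) (otherPegs (pegOf (st y) c 1) (upTo c)) eq
    ... | p , _ , top with only p k (head-member (st y p) top)
    ...   | refl = good-disk1 (st y) , keep₂ y only

odd : ℕ → Bool
odd zero    = false
odd (suc n) = not (odd n)

odd-double : ∀ j → odd (2 * j) ≡ false
odd-double j rewrite +-identityʳ j = odd-j+j j
  where
    odd-j+j : ∀ j → odd (j + j) ≡ false
    odd-j+j zero    = refl
    odd-j+j (suc j) rewrite +-suc j j | not-involutive (odd (j + j)) = odd-j+j j

-- Adding one at position k of a digit vector whose digits below k are
-- maximal: those digits wrap to 0 and digit k advances.
carry-digits : (ℕ → ℕ) → ℕ → ℕ → ℕ
carry-digits u k d = if d <ᵇ k then 0 else upd u k (suc (u k)) d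

carry-below : ∀ u k {d} → d < k → carry-digits u k d ≡ 0
carry-below u k d<k rewrite <ᵇ-yes d<k = refl

carry-at : ∀ u k → carry-digits u k k ≡ suc (u k)
carry-at u k rewrite <ᵇ-no (<-irrefl {k} refl) = upd-same u k _

carry-above : ∀ u k {d} → ¬ (d < k) → d ≢ k → carry-digits u k d ≡ u d
carry-above u k d≮k d≢k rewrite <ᵇ-no d≮k = upd-other u k _ d≢k

-- Reflected mixed-radix counters (ODD and ODD-COMPRESSED, e = m - 1).
-- Disk d carries a digit u d ∈ [0, e] and a reading direction π d; the
-- direction of a digit reverses each time the next higher digit is odd, as
-- in a reflected Gray code.  Read in its direction, the digit of D_d is the
-- peg D_d occupies in ODD.  A round of the algorithms adds one to this
-- counter: D_1 runs its digit from 0 to e, then the move of D_k is the carry.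
module Reflected (e : ℕ) (e-even : odd e ≡ false) (0<e : 0 < e) where

  place : ℕ → Bool → ℕ
  place u π = if π then e ∸ u else u

  IsEnd : ℕ → Set
  IsEnd x = x ≡ 0 ⊎ x ≡ e

  place-≤ : ∀ {u} π → u ≤ e → place u π ≤ e
  place-≤ {u} true  u≤e = m∸n≤m e u
  place-≤     false u≤e = u≤e

  place-flip : ∀ π → place 0 (not π) ≡ place e π
  place-flip true  = sym (n∸n≡0 e)
  place-flip false = refl

  place-injective : ∀ {u v} π → u ≤ e → v ≤ e → place u π ≡ place v π → u ≡ v
  place-injective true  u≤e v≤e eq = ∸-cancelˡ-≡ u≤e v≤e eq
  place-injective false u≤e v≤e eq = eq

  place-end : ∀ π → IsEnd (place e π)
  place-end true  = inj₁ (n∸n≡0 e)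
  place-end false = inj₂ refl

  end-place : ∀ {u} π → u ≤ e → IsEnd (place u π) → IsEnd u
  end-place false u≤e end = end
  end-place true  u≤e (inj₁ e∸u≡0) = inj₂ (∸-cancelˡ-≡ u≤e ≤-refl (trans e∸u≡0 (sym (n∸n≡0 e))))
  end-place true  u≤e (inj₂ e∸u≡e) = inj₁ (∸-cancelˡ-≡ u≤e z≤n e∸u≡e)

  end-even : ∀ {u} → IsEnd u → odd u ≡ false
  end-even (inj₁ refl) = refl
  end-even (inj₂ refl) = e-even

  below-top-odd : ∀ {u} → suc u ≡ e → odd u ≡ true
  below-top-odd {u} su≡e with odd u | trans (cong odd su≡e) e-even
  ... | true  | _  = refl
  ... | false | ()

  -- Advancing a non-maximal digit never reaches the end that a maximal
  -- digit read in direction π xor odd u occupies.  This makes carries legal.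
  advance-avoids-top : ∀ {u} π → u < e → place (suc u) π ≢ place e (π xor odd u)
  advance-avoids-top {u} π u<e with odd u in ou | π
  ... | false | false = λ su≡e → true≢false (trans (sym (below-top-odd su≡e)) ou)
  ... | true  | false = λ su≡e∸e → 1+n≢0 (trans su≡e∸e (n∸n≡0 e))
  ... | false | true  = λ e∸su≡0 →
    true≢false (trans (sym (below-top-odd (≤-antisym u<e (m∸n≡0⇒m≤n (trans e∸su≡0 (n∸n≡0 e)))))) ou)
  ... | true  | true  = λ e∸su≡e → <-irrefl e∸su≡e (∸-monoʳ-< (s≤s z≤n) u<e)

  record Counter (n a : ℕ) : Set where
    field
      u      : ℕ → ℕ
      π      : ℕ → Bool
      u-1    : u 1 ≡ a
      u-≤    : ∀ d → 2 ≤ d → d ≤ n → u d ≤ e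
      linked : ∀ d → 1 ≤ d → suc d ≤ n → π d ≡ π (suc d) xor odd (u (suc d))

    peg : ℕ → ℕ
    peg d = place (u d) (π d)

  u-≤-all : ∀ {n a} (C : Counter n a) → a ≤ e → ∀ d → 1 ≤ d → d ≤ n → Counter.u C d ≤ e
  u-≤-all C a≤e (suc zero)    _ _   = subst (_≤ e) (sym (Counter.u-1 C)) a≤e
  u-≤-all C a≤e (suc (suc d)) _ d≤n = Counter.u-≤ C (suc (suc d)) (s≤s (s≤s z≤n)) d≤n

  peg-on-board : ∀ {n a} (C : Counter n a) → a ≤ e → ∀ d → 1 ≤ d → d ≤ n → Counter.peg C d < suc e
  peg-on-board C a≤e d 1≤d d≤n = s≤s (place-≤ (Counter.π C d) (u-≤-all C a≤e d 1≤d d≤n))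

  set-digit1 : ∀ {n a} → Counter n a → ∀ b → Counter n b
  set-digit1 C b = record
    { u = upd u 1 b ; π = π ; u-1 = upd-same u 1 b
    ; u-≤ = λ d 2≤d d≤n → subst (_≤ e) (sym (upd-other u 1 b (≥2⇒≢1 2≤d))) (u-≤ d 2≤d d≤n)
    ; linked = λ d 1≤d sd≤n →
        subst (λ x → π d ≡ π (suc d) xor odd x) (sym (upd-other u 1 b (≥2⇒≢1 (s≤s 1≤d))))
          (linked d 1≤d sd≤n) }
    where open Counter C

  maximal-below : ∀ {n k} (C : Counter n e) → k ≤ n →
    (∀ d → 1 ≤ d → d < k → Counter.peg C d ≡ Counter.peg C 1) →
    ∀ d → 1 ≤ d → d < k → Counter.u C d ≡ e × Counter.π C d ≡ Counter.π C 1
  maximal-below C k≤n same (suc zero) _ _ = Counter.u-1 C , refl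
  maximal-below C k≤n same (suc (suc d)) _ d′<k
    with maximal-below C k≤n same (suc d) (s≤s z≤n) (<⇒≤ d′<k)
  ... | _ , πd≡π1 = u-max , π-same
    where
      open Counter C
      open ≡-Reasoning
      d′ = suc (suc d)
      d′≤n = ≤-trans (<⇒≤ d′<k) k≤n
      u≤e = u-≤ d′ (s≤s (s≤s z≤n)) d′≤n
      on-top : peg d′ ≡ place e (π 1)
      on-top = trans (same d′ (s≤s z≤n) d′<k) (cong (λ x → place x (π 1)) u-1)
      even : odd (u d′) ≡ false
      even = end-even (end-place (π d′) u≤e (subst IsEnd (sym on-top) (place-end (π 1))))
      π-same : π d′ ≡ π 1
      π-same = begin
        π d′                     ≡⟨ sym (xor-identityʳ (π d′)) ⟩
        π d′ xor false           ≡⟨ cong (π d′ xor_) (sym even) ⟩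
        π d′ xor odd (u d′)      ≡⟨ sym (linked (suc d) (s≤s z≤n) d′≤n) ⟩
        π (suc d)                ≡⟨ πd≡π1 ⟩
        π 1                      ∎
      u-max : u d′ ≡ e
      u-max = place-injective (π 1) u≤e ≤-refl (trans (cong (place (u d′)) (sym π-same)) on-top)

  record Carry {n} (C : Counter n e) (k : ℕ) : Set where
    open Counter C
    field
      2≤k    : 2 ≤ k
      k≤n    : k ≤ n
      maxed  : ∀ d → 1 ≤ d → d < k → u d ≡ e × π d ≡ π 1
      room   : u k < e
      parity : π 1 ≡ π k xor odd (u k)

  carry : ∀ {n k} (C : Counter n e) → 2 ≤ k → k ≤ n →
    (∀ d → 1 ≤ d → d < k → Counter.peg C d ≡ Counter.peg C 1) →
    Counter.peg C k ≢ Counter.peg C 1 → Carry C k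
  carry {n} {suc k′} C 2≤k k≤n same differ = record
    { 2≤k = 2≤k ; k≤n = k≤n ; maxed = maxed ; room = room ; parity = parity }
    where
      open Counter C
      maxed = maximal-below C k≤n same
      1≤k′ = ≤-pred 2≤k
      parity : π 1 ≡ π (suc k′) xor odd (u (suc k′))
      parity = trans (sym (proj₂ (maxed k′ 1≤k′ ≤-refl))) (linked k′ 1≤k′ k≤n)
      room : u (suc k′) < e
      room with u (suc k′) ≟ e
      ... | no uk≢e = ≤∧≢⇒< (u-≤ (suc k′) 2≤k k≤n) uk≢e
      ... | yes uk≡e = ⊥-elim (differ (begin
        place (u (suc k′)) (π (suc k′))  ≡⟨ cong (λ x → place x (π (suc k′))) uk≡e ⟩
        place e (π (suc k′))             ≡⟨ cong (place e) π-same ⟩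
        place e (π 1)                    ≡⟨ cong (λ x → place x (π 1)) (sym u-1) ⟩
        place (u 1) (π 1)                ∎))
        where
          open ≡-Reasoning
          π-same : π (suc k′) ≡ π 1
          π-same = sym (begin
            π 1                             ≡⟨ parity ⟩
            π (suc k′) xor odd (u (suc k′))  ≡⟨ cong (λ x → π (suc k′) xor odd x) uk≡e ⟩
            π (suc k′) xor odd e            ≡⟨ cong (π (suc k′) xor_) e-even ⟩
            π (suc k′) xor false            ≡⟨ xor-identityʳ _ ⟩
            π (suc k′)                      ∎)

  carry-legal : ∀ {n k} {C : Counter n e} → Carry C k →
    place (suc (Counter.u C k)) (Counter.π C k) ≢ Counter.peg C 1
  carry-legal {C = C} K eq = advance-avoids-top (π _) room
    (trans eq (trans (cong (λ x → place x (π 1)) u-1) (cong (place e) parity)))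
    where open Counter C
          open Carry K

  incr-u : ∀ {n a} → Counter n a → ℕ → ℕ → ℕ
  incr-u C = carry-digits (Counter.u C)

  incr-π : ∀ {n a} → Counter n a → ℕ → ℕ → Bool
  incr-π C k d = if d <ᵇ k then not (Counter.π C 1) else Counter.π C d

  module _ {n a} (C : Counter n a) (k : ℕ) where
    open Counter C

    incr-below : ∀ {d} → d < k → incr-u C k d ≡ 0 × incr-π C k d ≡ not (π 1)
    incr-below d<k rewrite <ᵇ-yes d<k = refl , refl

    incr-at : incr-u C k k ≡ suc (u k)
    incr-at = carry-at u k

    incr-above : ∀ {d} → ¬ (d < k) → d ≢ k → incr-u C k d ≡ u d
    incr-above = carry-above u k

    incr-π-from : ∀ {d} → ¬ (d < k) → incr-π C k d ≡ π d
    incr-π-from d≮k rewrite <ᵇ-no d≮k = refl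

  increment : ∀ {n k} {C : Counter n e} → Carry C k → Counter n 0
  increment {n} {k} {C} K = record
    { u = incr-u C k ; π = incr-π C k
    ; u-1 = proj₁ (incr-below C k 2≤k)
    ; u-≤ = bounded ; linked = linked⁺ }
    where
      open Counter C
      open Carry K
      bounded : ∀ d → 2 ≤ d → d ≤ n → incr-u C k d ≤ e
      bounded d 2≤d d≤n with <-cmp d k
      ... | tri< d<k _ _   = subst (_≤ e) (sym (proj₁ (incr-below C k d<k))) z≤n
      ... | tri≈ _ refl _  = subst (_≤ e) (sym (incr-at C k)) room
      ... | tri> d≮k d≢k _ = subst (_≤ e) (sym (incr-above C k d≮k d≢k)) (u-≤ d 2≤d d≤n)
      linked-cong : ∀ {a b c a′ b′ c′} → a ≡ a′ → b ≡ b′ → c ≡ c′ →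
        a′ ≡ b′ xor odd c′ → a ≡ b xor odd c
      linked-cong refl refl refl eq = eq
      linked⁺ : ∀ d → 1 ≤ d → suc d ≤ n → incr-π C k d ≡ incr-π C k (suc d) xor odd (incr-u C k (suc d))
      linked⁺ d 1≤d sd≤n with <-cmp (suc d) k
      ... | tri< sd<k _ _ =
        linked-cong (proj₂ (incr-below C k (<-trans (n<1+n d) sd<k))) (proj₂ (incr-below C k sd<k))
          (proj₁ (incr-below C k sd<k)) (sym (xor-identityʳ _))
      ... | tri≈ _ refl _ =
        linked-cong (proj₂ (incr-below C k (n<1+n d))) (incr-π-from C k (<-irrefl refl)) (incr-at C k)
          (trans (cong not parity) (not-distribʳ-xor (π (suc d)) (odd (u (suc d)))))
      ... | tri> sd≮k sd≢k k<sd =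
        linked-cong (incr-π-from C k (≤⇒≯ (≤-pred k<sd))) (incr-π-from C k sd≮k)
          (incr-above C k sd≮k sd≢k) (linked d 1≤d sd≤n)

  increment-peg : ∀ {n k} {C : Counter n e} (K : Carry C k) → ∀ d → 1 ≤ d → d ≤ n →
    upd (Counter.peg C) k (place (suc (Counter.u C k)) (Counter.π C k)) d ≡ Counter.peg (increment K) d
  increment-peg {n} {k} {C} K d 1≤d d≤n with <-cmp d k
  ... | tri< d<k d≢k _ = begin
    upd peg k _ d                     ≡⟨ upd-other peg k _ d≢k ⟩
    place (u d) (π d)                 ≡⟨ cong₂ place (proj₁ (maxed d 1≤d d<k)) (proj₂ (maxed d 1≤d d<k)) ⟩
    place e (π 1)                     ≡⟨ sym (place-flip (π 1)) ⟩
    place 0 (not (π 1))               ≡⟨ sym (cong₂ place (proj₁ wrapped) (proj₂ wrapped)) ⟩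
    place (incr-u C k d) (incr-π C k d) ∎
    where open Counter C
          open Carry K
          open ≡-Reasoning
          wrapped = incr-below C k d<k
  ... | tri≈ _ refl _ =
    trans (upd-same peg d _) (sym (cong₂ place (incr-at C d) (incr-π-from C d (<-irrefl refl))))
    where open Counter C
  ... | tri> d≮k d≢k _ =
    trans (upd-other peg k _ d≢k) (sym (cong₂ place (incr-above C k d≮k d≢k) (incr-π-from C k d≮k)))
    where open Counter C

-- At the start of a
-- round (lowest digit 0) and after the sweep of D_1 (lowest digit e), every
-- disk D_d lies on peg (place (u d) (π d)), and a disk in the middle of the
-- row last moved in the direction that advances its digit.
module OddAlgorithm (e : ℕ) (e-even : odd e ≡ false) (0<e : 0 < e) (n : ℕ) (1≤n : 1 ≤ n) where
  open Reflected e e-even 0<e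

  m : ℕ
  m = suc e

  heading-at : ℕ → Bool → Bool
  heading-at c h = if c ≡ᵇ 0 then true else if c ≡ᵇ e then false else h

  step-to : Bool → ℕ → ℕ
  step-to h c = if h then suc c else c ∸ 1

  advance : ∀ π {u} → u < e → step-to (not π) (place u π) ≡ place (suc u) π
  advance false     u<e = refl
  advance true {u} u<e = trans (∸-+-assoc e u 1) (cong (e ∸_) (+-comm u 1))

  -- A disk whose digit is below e moves so as to advance it: at an end of
  -- the row the direction is forced, in between it keeps its heading.
  heading-rule : ∀ π {u} h → u < e → (0 < u → h ≡ not π) → heading-at (place u π) h ≡ not π
  heading-rule false {zero}  h u<e mid = refl
  heading-rule true  {zero}  h u<e mid rewrite ≡ᵇ-≢ (>⇒≢ 0<e) | ≡ᵇ-refl e = refl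
  heading-rule false {suc u} h u<e mid rewrite ≡ᵇ-≢ (<⇒≢ u<e) = mid (s≤s z≤n)
  heading-rule true  {suc u} h u<e mid
    rewrite ≡ᵇ-≢ {e ∸ suc u} {0} (λ e∸su≡0 → <⇒≱ u<e (m∸n≡0⇒m≤n e∸su≡0))
          | ≡ᵇ-≢ {e ∸ suc u} {e} (<⇒≢ (∸-monoʳ-< (s≤s z≤n) (<⇒≤ u<e))) = mid (s≤s z≤n)

  start-heading : ∀ π → (place 0 π ≡ᵇ 0) ≡ not π
  start-heading false = refl
  start-heading true  = ≡ᵇ-≢ (>⇒≢ 0<e)

  record OddInv (a : ℕ) (x : OddState) : Set where
    field
      counter : Counter n a
      layout  : Layout n (Counter.peg counter) (proj₁ x)
      heading : ∀ d → 2 ≤ d → d ≤ n → 0 < Counter.u counter d → Counter.u counter d < e →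
                proj₂ x d ≡ not (Counter.π counter d)

  odd-start : OddInv 0 (oddInit n)
  odd-start = record
    { counter = record { u = λ _ → 0 ; π = λ _ → false ; u-1 = refl
                       ; u-≤ = λ _ _ _ → z≤n ; linked = λ _ _ _ → refl }
    ; layout = layout-init n
    ; heading = λ { _ _ _ () _ } }

  disk1-step : ∀ b a x → a < e → (I : OddInv a x) → Counter.π (OddInv.counter I) 1 ≡ b →
    Σ (OddInv (suc a) (oddStepDir m 1 (not b) x)) (λ J → Counter.π (OddInv.counter J) 1 ≡ b)
  disk1-step _ a (s , dir) a<e I refl = record { counter = C′ ; layout = layout′ ; heading = heading′ } , refl
    where
      open OddInv I
      open Counter counter
      C′ = set-digit1 counter (suc a)
      from : pegOf s m 1 ≡ place a (π 1)
      from = trans (pegOf-layout layout ≤-refl 1≤n (peg-on-board counter (<⇒≤ a<e) 1 ≤-refl 1≤n))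
                   (cong (λ x → place x (π 1)) u-1)
      to : step-to (not (π 1)) (pegOf s m 1) ≡ Counter.peg C′ 1
      to = trans (cong (step-to (not (π 1))) from)
                 (trans (advance (π 1) a<e) (cong (λ x → place x (π 1)) (sym (upd-same u 1 (suc a)))))
      layout′ : Layout n (Counter.peg C′) (moveTo 1 (step-to (not (π 1)) (pegOf s m 1)) s)
      layout′ = layout-ext (layout-move layout ≤-refl 1≤n (λ d 1≤d d<1 → ⊥-elim (nothing-below-1 1≤d d<1)))
        (λ d _ _ → upd-agrees peg (Counter.peg C′) 1 _ to
          (λ d d≢1 → cong (λ x → place x (π d)) (sym (upd-other u 1 (suc a) d≢1))) d)
      heading′ : ∀ d → 2 ≤ d → d ≤ n → 0 < Counter.u C′ d → Counter.u C′ d < e →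
        upd dir 1 (not (π 1)) d ≡ not (π d)
      heading′ d 2≤d d≤n 0<u u<e =
        trans (upd-other dir 1 _ d≢1) (heading d 2≤d d≤n (subst (0 <_) same 0<u) (subst (_< e) same u<e))
        where d≢1 = ≥2⇒≢1 2≤d
              same = upd-other u 1 (suc a) d≢1

  odd-tour : ∀ x → OddInv 0 x → OddInv e (iterN e (oddStepDir m 1 (pegOf (proj₁ x) m 1 ≡ᵇ 0)) x)
  odd-tour x I = subst (λ h → OddInv e (iterN e (oddStepDir m 1 h) x)) (sym heads) (proj₁ swept)
    where
      open OddInv I
      open Counter counter
      heads : (pegOf (proj₁ x) m 1 ≡ᵇ 0) ≡ not (π 1)
      heads = trans (cong (_≡ᵇ 0) (trans (pegOf-layout layout ≤-refl 1≤n (peg-on-board counter z≤n 1 ≤-refl 1≤n))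
                                         (cong (λ x → place x (π 1)) u-1)))
                    (start-heading (π 1))
      swept = iterN-climb (λ a y → Σ (OddInv a y) (λ J → Counter.π (OddInv.counter J) 1 ≡ π 1))
        (oddStepDir m 1 (not (π 1))) e (λ a y a<e (J , eq) → disk1-step (π 1) a y a<e J eq)
        e 0 x ≤-refl (I , refl)

  odd-carry : ∀ y k → OddInv e y → smallestTop (proj₁ y) (otherPegs (pegOf (proj₁ y) m 1) (upTo m)) ≡ just k →
    SmallerOnOnePeg (proj₁ y) k × OddInv 0 (oddStep m k y)
  odd-carry (s , dir) k I eq = chosen-good layout ch , record
    { counter = increment K ; layout = layout′ ; heading = heading′ }
    where
      open OddInv I
      open Counter counter
      on-board = peg-on-board counter ≤-refl
      ch : Chosen n peg (peg 1) k
      ch = chosen-in-round layout 1≤n on-board eq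
      open Chosen ch
      K : Carry counter k
      K = carry counter (≤∧≢⇒< 1≤k (λ 1≡k → not-on-p (cong peg (sym 1≡k)))) k≤n smaller-on-p not-on-p
      open Carry K using (room)
      at-k : pegOf s m k ≡ peg k
      at-k = pegOf-layout layout 1≤k k≤n (on-board k 1≤k k≤n)
      2≤k = Carry.2≤k K
      heads : heading-at (pegOf s m k) (dir k) ≡ not (π k)
      heads = trans (cong (λ c → heading-at c (dir k)) at-k)
                   (heading-rule (π k) (dir k) room (λ 0<u → heading k 2≤k k≤n 0<u room))
      target : step-to (heading-at (pegOf s m k) (dir k)) (pegOf s m k) ≡ place (suc (u k)) (π k)
      target = trans (cong₂ step-to heads at-k) (advance (π k) room)
      legal : ∀ d → 1 ≤ d → d < k → peg d ≢ place (suc (u k)) (π k)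
      legal d 1≤d d<k eq = carry-legal K (trans (sym eq) (smaller-on-p d 1≤d d<k))
      layout′ : Layout n (Counter.peg (increment K)) (proj₁ (oddStep m k (s , dir)))
      layout′ = subst (λ t → Layout n (Counter.peg (increment K)) (moveTo k t s)) (sym target)
        (layout-ext (layout-move layout 1≤k k≤n legal) (increment-peg K))
      heading′ : ∀ d → 2 ≤ d → d ≤ n → 0 < incr-u counter k d → incr-u counter k d < e →
        upd dir k (heading-at (pegOf s m k) (dir k)) d ≡ not (incr-π counter k d)
      heading′ d 2≤d d≤n 0<u u<e with <-cmp d k
      ... | tri< d<k _ _ = ⊥-elim (<-irrefl (sym (proj₁ (incr-below counter k d<k))) 0<u)
      ... | tri≈ _ refl _ =
        trans (upd-same dir d _) (trans heads (cong not (sym (incr-π-from counter d (<-irrefl refl)))))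
      ... | tri> d≮k d≢k _ = trans (upd-other dir k _ d≢k) (trans
        (heading d 2≤d d≤n (subst (0 <_) same 0<u) (subst (_< e) same u<e))
        (cong not (sym (incr-π-from counter k d≮k))))
        where same = incr-above counter k d≮k d≢k

  odd-run : GoodRun (oddInit n) (oddRound m)
  odd-run = goodRun-cong (oddRound-shape m)
    (twoPhase-good proj₁ m e (λ x → oddStepDir m 1 (pegOf (proj₁ x) m 1 ≡ᵇ 0)) (oddStep m)
      (OddInv 0) (OddInv e) odd-tour odd-carry (oddInit n) odd-start)

-- Algorithm ODD-COMPRESSED with m = e + 1.  Its dial runs through the 2e
-- states 0,1↑,…,(e-1)↑,e,(e-1)↓,…,1↓; the dial of D_d encodes the digit of
-- D_d read in its direction, and P_0, P_1, P_2 are the pegs of ODD with the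
-- inner pegs P_1,…,P_{e-1} merged.  Hence the same counter governs both.
module CompressedAlgorithm (e : ℕ) (e-even : odd e ≡ false) (0<e : 0 < e) (n : ℕ) (1≤n : 1 ≤ n) where
  open Reflected e e-even 0<e

  m : ℕ
  m = suc e

  squash : ℕ → ℕ
  squash = dialPeg m

  squash<3 : ∀ j → squash j < 3
  squash<3 j with j ≡ᵇ 0
  ... | true  = s≤s z≤n
  ... | false with j ≡ᵇ e
  ...   | true  = ≤-refl
  ...   | false = s≤s (s≤s z≤n)

  squash-end : ∀ {x y} → IsEnd y → squash x ≡ squash y → x ≡ y
  squash-end {x} (inj₁ refl) eq with x ≡ᵇ 0 in x≡0
  ... | true = ≡ᵇ-sound x≡0
  ... | false with x ≡ᵇ e
  squash-end (inj₁ refl) () | false | true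
  squash-end (inj₁ refl) () | false | false
  squash-end {x} (inj₂ refl) eq with x ≡ᵇ 0 | x ≡ᵇ e in x≡e | trans eq (squash-e)
    where
      squash-e : squash e ≡ 2
      squash-e rewrite ≡ᵇ-≢ (>⇒≢ 0<e) | ≡ᵇ-refl e = refl
  ... | true  | _     | ()
  ... | false | true  | _  = ≡ᵇ-sound x≡e
  ... | false | false | ()

  Shows : ℕ → ℕ → Bool → Set
  Shows j u false = j ≡ u
  Shows j u true  = (u < e × j ≡ u + e) ⊎ (u ≡ e × j ≡ 0)

  shows-peg : ∀ {j u} π → Shows j u π → u ≤ e → squash j ≡ squash (place u π)
  shows-peg false refl u≤e = refl
  shows-peg {u = zero} true (inj₁ (_ , refl)) u≤e = refl
  shows-peg {u = suc u} true (inj₁ (u<e , refl)) u≤e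
    rewrite ≡ᵇ-≢ {e ∸ suc u} {0} (λ e∸su≡0 → <⇒≱ u<e (m∸n≡0⇒m≤n e∸su≡0))
          | ≡ᵇ-≢ {e ∸ suc u} {e} (<⇒≢ (∸-monoʳ-< (s≤s z≤n) (<⇒≤ u<e)))
          | ≡ᵇ-≢ {suc u + e} {e} (>⇒≢ (subst (e <_) (+-comm e (suc u)) (m<m+n e (s≤s z≤n)))) = refl
  shows-peg true (inj₂ (refl , refl)) u≤e rewrite n∸n≡0 e = refl

  period : 2 * m ∸ 2 ≡ e + e
  period rewrite +-identityʳ e | +-suc e e = refl

  dialNext-step : ∀ {j} → suc j < e + e → dialNext m j ≡ suc j
  dialNext-step {j} sj<2e rewrite period | ≡ᵇ-≢ (<⇒≢ sj<2e) = refl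

  dialNext-wrap : ∀ {j} → suc j ≡ e + e → dialNext m j ≡ 0
  dialNext-wrap {j} sj≡2e rewrite period | sj≡2e | ≡ᵇ-refl (e + e) = refl

  shows-advance : ∀ {j u} π → Shows j u π → u < e → Shows (dialNext m j) (suc u) π
  shows-advance false refl u<e = dialNext-step (<-≤-trans (s≤s u<e) (subst (suc e ≤_) (+-comm e e) (m<m+n e 0<e)))
  shows-advance {u = u} true (inj₁ (_ , refl)) u<e with suc u ≟ e
  ... | yes su≡e = inj₂ (su≡e , dialNext-wrap (cong (_+ e) su≡e))
  ... | no su≢e  = inj₁ (≤∧≢⇒< u<e su≢e , dialNext-step (+-monoˡ-< e (≤∧≢⇒< u<e su≢e)))
  shows-advance true (inj₂ (refl , _)) u<e = ⊥-elim (<-irrefl refl u<e)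

  shows-flip : ∀ {j} π → Shows j e π → Shows j 0 (not π)
  shows-flip false j≡e = inj₁ (0<e , j≡e)
  shows-flip true (inj₁ (e<e , _)) = ⊥-elim (<-irrefl refl e<e)
  shows-flip true (inj₂ (_ , j≡0)) = j≡0

  squash-upd : ∀ dial k j d → upd (squash ∘ dial) k (squash j) d ≡ squash (upd dial k j d)
  squash-upd dial k j d with d ≡ᵇ k
  ... | true  = refl
  ... | false = refl

  turn-layout : ∀ {s dial k} → Layout n (squash ∘ dial) s → 1 ≤ k → k ≤ n →
    (∀ d → 1 ≤ d → d < k → squash (dial d) ≢ squash (dialNext m (dial k))) →
    Layout n (squash ∘ proj₂ (turn m k (s , dial))) (proj₁ (turn m k (s , dial)))
  turn-layout {s} {dial} {k} L 1≤k k≤n legal with pegOf s 3 k ≡ᵇ dialPeg m (dialNext m (dial k)) in stays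
  ... | true  = layout-ext L λ d _ _ →
    trans (sym (upd-agrees (squash ∘ dial) (squash ∘ dial) k _ (sym at) (λ _ _ → refl) d)) (squash-upd dial k _ d)
    where
      at : squash (dial k) ≡ squash (dialNext m (dial k))
      at = trans (sym (pegOf-layout L 1≤k k≤n (squash<3 (dial k)))) (≡ᵇ-sound stays)
  ... | false = layout-ext (layout-move L 1≤k k≤n legal) λ d _ _ → squash-upd dial k _ d

  record CompInv (a : ℕ) (x : CompState) : Set where
    field
      counter : Counter n a
      shows   : ∀ d → 1 ≤ d → d ≤ n → Shows (proj₂ x d) (Counter.u counter d) (Counter.π counter d)
      layout  : Layout n (squash ∘ proj₂ x) (proj₁ x)

  comp-start : CompInv 0 (compInit n)
  comp-start = record
    { counter = record { u = λ _ → 0 ; π = λ _ → false ; u-1 = refl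
                       ; u-≤ = λ _ _ _ → z≤n ; linked = λ _ _ _ → refl }
    ; shows = λ _ _ _ → refl
    ; layout = layout-init n }

  disk1-turn : ∀ a x → a < e → CompInv a x → CompInv (suc a) (turn m 1 x)
  disk1-turn a (s , dial) a<e I = record
    { counter = set-digit1 counter (suc a)
    ; shows = shows′
    ; layout = turn-layout layout ≤-refl 1≤n (λ d 1≤d d<1 → ⊥-elim (nothing-below-1 1≤d d<1)) }
    where
      open CompInv I
      open Counter counter
      shows′ : ∀ d → 1 ≤ d → d ≤ n → Shows (upd dial 1 (dialNext m (dial 1)) d) (upd u 1 (suc a) d) (π d)
      shows′ d 1≤d d≤n with d ≟ 1
      ... | yes refl rewrite upd-same dial 1 (dialNext m (dial 1)) | upd-same u 1 (suc a) =
        shows-advance (π 1) (subst (λ v → Shows (dial 1) v (π 1)) u-1 (shows 1 ≤-refl 1≤n)) a<e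
      ... | no d≢1 rewrite upd-other dial 1 (dialNext m (dial 1)) d≢1 | upd-other u 1 (suc a) d≢1 =
        shows d 1≤d d≤n

  comp-tour : ∀ x → CompInv 0 x → CompInv e (iterN e (turn m 1) x)
  comp-tour x I = iterN-climb CompInv (turn m 1) e disk1-turn e 0 x ≤-refl I

  comp-carry : ∀ y k → CompInv e y → smallestTop (proj₁ y) (otherPegs (pegOf (proj₁ y) 3 1) (upTo 3)) ≡ just k →
    SmallerOnOnePeg (proj₁ y) k × CompInv 0 (turn m k y)
  comp-carry (s , dial) k I eq = chosen-good layout ch , record
    { counter = increment K ; shows = shows′ ; layout = turn-layout layout 1≤k k≤n legal }
    where
      open CompInv I
      open Counter counter
      ch : Chosen n (squash ∘ dial) (squash (dial 1)) k
      ch = chosen-in-round layout 1≤n (λ d _ _ → squash<3 (dial d)) eq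
      open Chosen ch
      squashed : ∀ d → 1 ≤ d → d ≤ n → squash (dial d) ≡ squash (peg d)
      squashed d 1≤d d≤n = shows-peg (π d) (shows d 1≤d d≤n) (u-≤-all counter ≤-refl d 1≤d d≤n)
      peg1-end : IsEnd (peg 1)
      peg1-end = subst (λ v → IsEnd (place v (π 1))) (sym u-1) (place-end (π 1))
      with-1 : ∀ {x} → squash x ≡ squash (dial 1) → x ≡ peg 1
      with-1 eq = squash-end peg1-end (trans eq (squashed 1 ≤-refl 1≤n))
      K : Carry counter k
      K = carry counter (≤∧≢⇒< 1≤k (λ 1≡k → not-on-p (cong (squash ∘ dial) (sym 1≡k)))) k≤n
        (λ d 1≤d d<k → with-1 (trans (sym (squashed d 1≤d (≤-trans (<⇒≤ d<k) k≤n))) (smaller-on-p d 1≤d d<k)))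
        (λ eq → not-on-p (trans (squashed k 1≤k k≤n) (trans (cong squash eq) (sym (squashed 1 ≤-refl 1≤n)))))
      open Carry K using (room; maxed)
      advanced : Shows (dialNext m (dial k)) (suc (u k)) (π k)
      advanced = shows-advance (π k) (shows k 1≤k k≤n) room
      legal : ∀ d → 1 ≤ d → d < k → squash (dial d) ≢ squash (dialNext m (dial k))
      legal d 1≤d d<k eq = carry-legal K
        (with-1 (trans (sym (shows-peg (π k) advanced room)) (trans (sym eq) (smaller-on-p d 1≤d d<k))))
      shows-cong : ∀ {j u π j′ u′ π′} → j ≡ j′ → u ≡ u′ → π ≡ π′ → Shows j u π → Shows j′ u′ π′
      shows-cong refl refl refl sh = sh
      shows′ : ∀ d → 1 ≤ d → d ≤ n →
        Shows (upd dial k (dialNext m (dial k)) d) (incr-u counter k d) (incr-π counter k d)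
      shows′ d 1≤d d≤n with <-cmp d k
      ... | tri< d<k d≢k _ =
        shows-cong (sym (upd-other dial k _ d≢k)) (sym (proj₁ wrapped)) (sym (proj₂ wrapped))
          (shows-flip (π 1) (shows-cong refl (proj₁ maximal) (proj₂ maximal) (shows d 1≤d d≤n)))
        where wrapped = incr-below counter k d<k
              maximal = maxed d 1≤d d<k
      ... | tri≈ _ refl _ =
        shows-cong (sym (upd-same dial d _)) (sym (incr-at counter d))
          (sym (incr-π-from counter d (<-irrefl refl))) advanced
      ... | tri> d≮k d≢k _ =
        shows-cong (sym (upd-other dial k _ d≢k)) (sym (incr-above counter k d≮k d≢k))
          (sym (incr-π-from counter k d≮k)) (shows d 1≤d d≤n)

  comp-run : GoodRun (compInit n) (compRound m)
  comp-run = goodRun-cong (compRound-shape m)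
    (twoPhase-good proj₁ 3 e (λ _ → turn m 1) (turn m) (CompInv 0) (CompInv e) comp-tour comp-carry
      (compInit n) comp-start)

module Modular (P′ : ℕ) where
  P : ℕ
  P = suc P′

  infix 4 _≡ₘ_
  record _≡ₘ_ (a b : ℕ) : Set where
    constructor mod-eq
    field residues : a % P ≡ b % P

  ≡⇒≡ₘ : ∀ {a b} → a ≡ b → a ≡ₘ b
  ≡⇒≡ₘ refl = mod-eq refl

  ≡ₘ-setoid : Setoid _ _
  ≡ₘ-setoid = record
    { Carrier = ℕ ; _≈_ = _≡ₘ_
    ; isEquivalence = record
      { refl  = mod-eq refl
      ; sym   = λ { (mod-eq eq) → mod-eq (sym eq) }
      ; trans = λ { (mod-eq eq) (mod-eq eq′) → mod-eq (trans eq eq′) } } }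

  open Setoid ≡ₘ-setoid public using () renaming (sym to ≡ₘ-sym; trans to ≡ₘ-trans)

  %-≡ₘ : ∀ a → a % P ≡ₘ a
  %-≡ₘ a = mod-eq (m%n%n≡m%n a P)

  +P-≡ₘ : ∀ a → a + P ≡ₘ a
  +P-≡ₘ a = mod-eq ([m+n]%n≡m%n a P)

  +-congʳ : ∀ {a b} c → a ≡ₘ b → a + c ≡ₘ b + c
  +-congʳ {a} {b} c (mod-eq eq) =
    mod-eq (trans (%-distribˡ-+ a c P) (trans (cong (λ x → (x + c % P) % P) eq) (sym (%-distribˡ-+ b c P))))

  +-congˡ : ∀ {a b} c → a ≡ₘ b → c + a ≡ₘ c + b
  +-congˡ {a} {b} c a≡b =
    ≡ₘ-trans (≡⇒≡ₘ (+-comm c a)) (≡ₘ-trans (+-congʳ c a≡b) (≡⇒≡ₘ (+-comm b c)))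

  +-cancelʳ : ∀ {a b} c → a + c ≡ₘ b + c → a ≡ₘ b
  +-cancelʳ {a} {b} c eq = begin
    a                           ≈⟨ ≡ₘ-sym (complement a) ⟩
    a + c % P + (P ∸ c % P)     ≈⟨ +-congʳ (P ∸ c % P) reduced ⟩
    b + c % P + (P ∸ c % P)     ≈⟨ complement b ⟩
    b                           ∎
    where
      open import Relation.Binary.Reasoning.Setoid ≡ₘ-setoid
      complement : ∀ x → x + c % P + (P ∸ c % P) ≡ₘ x
      complement x = ≡ₘ-trans
        (≡⇒≡ₘ (trans (+-assoc x (c % P) (P ∸ c % P)) (cong (x +_) (m+[n∸m]≡n (<⇒≤ (m%n<n c P))))))
        (+P-≡ₘ x)
      reduced : a + c % P ≡ₘ b + c % P
      reduced = ≡ₘ-trans (+-congˡ a (%-≡ₘ c)) (≡ₘ-trans eq (+-congˡ b (≡ₘ-sym (%-≡ₘ c))))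

  +-cancelˡ : ∀ {a b} c → c + a ≡ₘ c + b → a ≡ₘ b
  +-cancelˡ {a} {b} c eq =
    +-cancelʳ c (≡ₘ-trans (≡⇒≡ₘ (+-comm a c)) (≡ₘ-trans eq (≡⇒≡ₘ (+-comm c b))))

  ≡ₘ-small : ∀ {a b} → a < P → b < P → a ≡ₘ b → a ≡ b
  ≡ₘ-small a<P b<P (mod-eq eq) = trans (sym (m<n⇒m%n≡m a<P)) (trans eq (m<n⇒m%n≡m b<P))

isOdd≡odd : ∀ k → isOdd k ≡ odd k
isOdd≡odd zero          = refl
isOdd≡odd (suc zero)    = refl
isOdd≡odd (suc (suc k)) =
  trans (cong (_≡ᵇ 1) (trans (cong (_% 2) (+-comm 2 k)) ([m+n]%n≡m%n k 2)))
        (trans (isOdd≡odd k) (sym (not-involutive (odd k))))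

-- Consecutive disks move in opposite directions.
isOdd-suc : ∀ k → isOdd (suc k) ≡ not (isOdd k)
isOdd-suc k = trans (isOdd≡odd (suc k)) (cong not (sym (isOdd≡odd k)))

-- Algorithm EVEN with m = m₁ + 1 and P = m + 1 pegs in a cycle.  Here too a round adds one to a counter with digits
-- u d < m, where u 1 runs from 0 to m₁ during the tour of D_1.  The pegs are
-- not a function of the digits alone; instead consecutive disks are linked
-- by a congruence modulo P relating their digits and pegs.
module EvenAlgorithm (m₁ : ℕ) (n : ℕ) (1≤n : 1 ≤ n) where
  m : ℕ
  m = suc m₁

  open Modular m
  open import Relation.Binary.Reasoning.Setoid ≡ₘ-setoid

  Step : Bool → ℕ → ℕ → Set
  Step true  q t = t ≡ₘ suc q
  Step false q t = t ≡ₘ q + m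

  -- The link between D_d (digit a, peg p) and D_{d+1} (digit b, peg q);
  -- c tells whether D_{d+1} moves clockwise.
  LinkEq : Bool → ℕ → ℕ → ℕ → ℕ → Set
  LinkEq true  a p b q = a + p ≡ₘ b + q
  LinkEq false a p b q = a + q ≡ₘ b + p

  record Link (c : Bool) (a p b q : ℕ) : Set where
    constructor link
    field equation : LinkEq c a p b q

  link-cong : ∀ {c a p b q a′ p′ b′ q′} → a ≡ a′ → p ≡ p′ → b ≡ b′ → q ≡ q′ →
    Link c a p b q → Link c a′ p′ b′ q′
  link-cong refl refl refl refl l = l

  link-zero : ∀ c → Link c 0 0 0 0
  link-zero true  = link (≡⇒≡ₘ refl)
  link-zero false = link (≡⇒≡ₘ refl)

  link-same-peg : ∀ {c a b p} → Link c a p b p → a ≡ₘ b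
  link-same-peg {true}  {p = p} (link l) = +-cancelʳ p l
  link-same-peg {false} {p = p} (link l) = +-cancelʳ p l

  link-same-digit : ∀ {c a p q} → Link c a p a q → p ≡ₘ q
  link-same-digit {true}  {a} (link l) = +-cancelˡ a l
  link-same-digit {false} {a} (link l) = ≡ₘ-sym (+-cancelˡ a l)

  link-wrap : ∀ {c p q} → Link c m₁ p m₁ q → Link c 0 p 0 q
  link-wrap {true}  (link l) = link (+-cancelˡ m₁ l)
  link-wrap {false} (link l) = link (+-cancelˡ m₁ l)

  link-carry : ∀ {c p b q t} → Link c m₁ p b q → Step c q t → Link c 0 p (suc b) t
  link-carry {true} {p} {b} {q} {t} (link l) step = link (begin
    p                ≈⟨ ≡ₘ-sym (+P-≡ₘ p) ⟩
    p + suc m        ≡⟨ regroup p m₁ ⟩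
    m₁ + p + 2       ≈⟨ +-congʳ 2 l ⟩
    b + q + 2        ≡⟨ spread b q ⟩
    suc b + suc q    ≈⟨ +-congˡ (suc b) (≡ₘ-sym step) ⟩
    suc b + t        ∎)
    where
      regroup : ∀ p m₁ → p + suc (suc m₁) ≡ m₁ + p + 2
      regroup = solve-∀
      spread : ∀ b q → b + q + 2 ≡ suc b + suc q
      spread = solve-∀
  link-carry {false} {p} {b} {q} {t} (link l) step = link (begin
    t                ≈⟨ step ⟩
    q + m            ≡⟨ trans (+-suc q m₁) (cong suc (+-comm q m₁)) ⟩
    suc (m₁ + q)     ≈⟨ +-congˡ 1 l ⟩
    suc b + p        ∎)

  link-advance : ∀ {c a p b q t} → Link c a p b q → Step (not c) p t → Link c (suc a) t b q
  link-advance {true} {a} {p} {b} {q} {t} (link l) step = link (begin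
    suc a + t        ≈⟨ +-congˡ (suc a) step ⟩
    suc a + (p + m)  ≡⟨ regroup a p m₁ ⟩
    a + p + P        ≈⟨ +P-≡ₘ (a + p) ⟩
    a + p            ≈⟨ l ⟩
    b + q            ∎)
    where
      regroup : ∀ a p m₁ → suc a + (p + suc m₁) ≡ a + p + suc (suc m₁)
      regroup = solve-∀
  link-advance {false} {a} {p} {b} {q} {t} (link l) step = link (begin
    suc a + q        ≈⟨ +-congˡ 1 l ⟩
    suc (b + p)      ≡⟨ sym (+-suc b p) ⟩
    b + suc p        ≈⟨ +-congˡ b (≡ₘ-sym step) ⟩
    b + t            ∎)

  link-blocked : ∀ {c p b q t} → Link c m₁ p b q → b < m → Step c q t → p ≢ t
  link-blocked {c} {p} {b} {q} (link l) b<m step refl =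
    <-irrefl (sym (≡ₘ-small ≤-refl (<-trans b<m ≤-refl) (+-cancelʳ q (m+q≡b+q c l step)))) b<m
    where
      m+q≡b+q : ∀ c → LinkEq c m₁ p b q → Step c q p → m + q ≡ₘ b + q
      m+q≡b+q true l step = begin
        m + q            ≡⟨ sym (+-suc m₁ q) ⟩
        m₁ + suc q       ≈⟨ +-congˡ m₁ (≡ₘ-sym step) ⟩
        m₁ + p           ≈⟨ l ⟩
        b + q            ∎
      m+q≡b+q false l step = begin
        m + q            ≡⟨ +-comm 1 (m₁ + q) ⟩
        m₁ + q + 1       ≈⟨ +-congʳ 1 l ⟩
        b + p + 1        ≈⟨ +-congʳ 1 (+-congˡ b step) ⟩
        b + (q + m) + 1  ≡⟨ regroup b q m₁ ⟩
        b + q + P        ≈⟨ +P-≡ₘ (b + q) ⟩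
        b + q            ∎
        where
          regroup : ∀ b q m₁ → b + (q + suc m₁) + 1 ≡ b + q + suc (suc m₁)
          regroup = solve-∀

  Linked : (u pos : ℕ → ℕ) → ℕ → Set
  Linked u pos d = Link (isOdd (suc d)) (u d) (pos d) (u (suc d)) (pos (suc d))

  target : ℕ → ℕ → ℕ
  target k c = if isOdd k then cw m c else ccw m c

  target-step : ∀ k c → Step (isOdd k) c (target k c)
  target-step k c with isOdd k
  ... | true  = %-≡ₘ (suc c)
  ... | false = %-≡ₘ (c + m)

  target-< : ∀ k c → target k c < P
  target-< k c with isOdd k
  ... | true  = m%n<n (suc c) P
  ... | false = m%n<n (c + m) P

  record EvenInv (a : ℕ) (s : Stacks) : Set where
    field
      u      : ℕ → ℕ
      pos    : ℕ → ℕ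
      u-1    : u 1 ≡ a
      u-<    : ∀ d → 2 ≤ d → d ≤ n → u d < m
      pos-<  : ∀ d → 1 ≤ d → d ≤ n → pos d < P
      linked : ∀ d → 1 ≤ d → suc d ≤ n → Linked u pos d
      layout : Layout n pos s

  even-start : EvenInv 0 (initStacks n)
  even-start = record
    { u = λ _ → 0 ; pos = λ _ → 0 ; u-1 = refl
    ; u-< = λ _ _ _ → s≤s z≤n ; pos-< = λ _ _ _ → s≤s z≤n
    ; linked = λ d _ _ → link-zero (isOdd (suc d))
    ; layout = layout-init n }

  disk1-move : ∀ a s → a < m₁ → EvenInv a s → EvenInv (suc a) (evenStep m 1 s)
  disk1-move a s a<m₁ I = record
    { u = upd u 1 (suc a) ; pos = upd pos 1 t ; u-1 = upd-same u 1 (suc a)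
    ; u-< = λ d 2≤d d≤n → subst (_< m) (sym (upd-other u 1 _ (≥2⇒≢1 2≤d))) (u-< d 2≤d d≤n)
    ; pos-< = pos-<′ ; linked = linked′
    ; layout = layout-move layout ≤-refl 1≤n (λ d 1≤d d<1 → ⊥-elim (nothing-below-1 1≤d d<1)) }
    where
      open EvenInv I
      t = target 1 (pegOf s P 1)
      two≢1 : 2 ≢ 1
      two≢1 ()
      step : Step true (pos 1) t
      step = subst (λ c → Step true c t) (pegOf-layout layout ≤-refl 1≤n (pos-< 1 ≤-refl 1≤n))
        (target-step 1 (pegOf s P 1))
      pos-<′ : ∀ d → 1 ≤ d → d ≤ n → upd pos 1 t d < P
      pos-<′ d 1≤d d≤n with d ≟ 1
      ... | yes refl = subst (_< P) (sym (upd-same pos 1 t)) (target-< 1 (pegOf s P 1))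
      ... | no d≢1   = subst (_< P) (sym (upd-other pos 1 t d≢1)) (pos-< d 1≤d d≤n)
      linked′ : ∀ d → 1 ≤ d → suc d ≤ n → Linked (upd u 1 (suc a)) (upd pos 1 t) d
      linked′ d 1≤d sd≤n with d ≟ 1
      ... | yes refl = link-cong (sym (upd-same u 1 _)) (sym (upd-same pos 1 t))
                         (sym (upd-other u 1 (suc a) two≢1)) (sym (upd-other pos 1 t two≢1))
                         (link-advance (link-cong u-1 refl refl refl (linked 1 ≤-refl sd≤n)) step)
      ... | no d≢1 = link-cong (sym (upd-other u 1 _ d≢1)) (sym (upd-other pos 1 _ d≢1))
                       (sym (upd-other u 1 _ (≥2⇒≢1 (s≤s 1≤d)))) (sym (upd-other pos 1 _ (≥2⇒≢1 (s≤s 1≤d))))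
                       (linked d 1≤d sd≤n)

  even-tour : ∀ s → EvenInv 0 s → EvenInv m₁ (iterN m₁ (evenStep m 1) s)
  even-tour s = iterN-climb EvenInv (evenStep m 1) m₁ disk1-move m₁ 0 s ≤-refl

  digit-< : ∀ {a s} (I : EvenInv a s) → a < m → ∀ d → 1 ≤ d → d ≤ n → EvenInv.u I d < m
  digit-< I a<m (suc zero)    _ _   = subst (_< m) (sym (EvenInv.u-1 I)) a<m
  digit-< I a<m (suc (suc d)) _ d≤n = EvenInv.u-< I (suc (suc d)) (s≤s (s≤s z≤n)) d≤n

  all-maximal : ∀ {s k} (I : EvenInv m₁ s) → k ≤ n →
    (∀ d → 1 ≤ d → d < k → EvenInv.pos I d ≡ EvenInv.pos I 1) →
    ∀ d → 1 ≤ d → d < k → EvenInv.u I d ≡ m₁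
  all-maximal I k≤n same (suc zero)    _ _ = EvenInv.u-1 I
  all-maximal I k≤n same (suc (suc d)) _ d′<k =
    trans (sym (≡ₘ-small (digit<P d d≤n) (digit<P (suc d) d′≤n) (link-same-peg linked-same)))
          (all-maximal I k≤n same (suc d) (s≤s z≤n) (<⇒≤ d′<k))
    where
      open EvenInv I
      d′≤n = ≤-trans (<⇒≤ d′<k) k≤n
      d≤n = ≤-trans (n≤1+n (suc d)) d′≤n
      digit<P : ∀ d → suc d ≤ n → u (suc d) < P
      digit<P d d≤n = m<n⇒m<1+n (digit-< I ≤-refl (suc d) (s≤s z≤n) d≤n)
      linked-same : Link (isOdd (suc (suc d))) (u (suc d)) (pos (suc d)) (u (suc (suc d))) (pos (suc d))
      linked-same = link-cong refl refl refl (trans (same _ (s≤s z≤n) d′<k) (sym (same _ (s≤s z≤n) (<⇒≤ d′<k))))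
        (linked (suc d) (s≤s z≤n) d′≤n)

  carry-linked : ∀ {u pos k t} → (∀ d → 1 ≤ d → suc d ≤ n → Linked u pos d) →
    (∀ d → 1 ≤ d → d < k → u d ≡ m₁) → Step (isOdd k) (pos k) t →
    ∀ d → 1 ≤ d → suc d ≤ n → Linked (carry-digits u k) (upd pos k t) d
  carry-linked {u} {pos} {k} {t} linked maxed step d 1≤d sd≤n with <-cmp (suc d) k
  ... | tri< sd<k _ _ =
    link-cong (sym (carry-below u k d<k)) (sym (upd-other pos k t (<⇒≢ d<k)))
              (sym (carry-below u k sd<k)) (sym (upd-other pos k t (<⇒≢ sd<k)))
      (link-wrap (link-cong (maxed d 1≤d d<k) refl (maxed (suc d) (s≤s z≤n) sd<k) refl (linked d 1≤d sd≤n)))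
    where d<k = <-trans (n<1+n d) sd<k
  ... | tri≈ _ refl _ =
    link-cong (sym (carry-below u (suc d) (n<1+n d))) (sym (upd-other pos (suc d) t (<⇒≢ (n<1+n d))))
              (sym (carry-at u (suc d))) (sym (upd-same pos (suc d) t))
      (link-carry (link-cong (maxed d 1≤d (n<1+n d)) refl refl refl (linked d 1≤d sd≤n)) step)
  ... | tri> sd≮k sd≢k k<sd with d ≟ k
  ...   | yes refl =
    link-cong (sym (carry-at u d)) (sym (upd-same pos d t))
              (sym (carry-above u d sd≮k sd≢k)) (sym (upd-other pos d t sd≢k))
      (link-advance (linked d 1≤d sd≤n) (subst (λ c → Step c (pos d) t) opposite step))
    where
      opposite : isOdd d ≡ not (isOdd (suc d))
      opposite = trans (sym (not-involutive (isOdd d))) (cong not (sym (isOdd-suc d)))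
  ...   | no d≢k =
    link-cong (sym (carry-above u k d≮k d≢k)) (sym (upd-other pos k t d≢k))
              (sym (carry-above u k sd≮k sd≢k)) (sym (upd-other pos k t sd≢k))
      (linked d 1≤d sd≤n)
    where d≮k = ≤⇒≯ (≤-pred k<sd)

  link-below-chosen : ∀ {s k} (I : EvenInv m₁ s) → 1 < k → k ≤ n →
    (∀ d → 1 ≤ d → d < k → EvenInv.pos I d ≡ EvenInv.pos I 1) →
    Link (isOdd k) m₁ (EvenInv.pos I 1) (EvenInv.u I k) (EvenInv.pos I k)
  link-below-chosen {k = suc k′} I (s≤s 1≤k′) k≤n same =
    link-cong (all-maximal I k≤n same k′ 1≤k′ ≤-refl) (same k′ 1≤k′ ≤-refl) refl refl
      (EvenInv.linked I k′ 1≤k′ k≤n)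

  even-carry : ∀ s k → EvenInv m₁ s → smallestTop s (otherPegs (pegOf s P 1) (upTo P)) ≡ just k →
    SmallerOnOnePeg s k × EvenInv 0 (evenStep m k s)
  even-carry s k I eq = chosen-good layout ch , record
    { u = carry-digits u k ; pos = upd pos k t ; u-1 = carry-below u k 1<k
    ; u-< = u-<′ ; pos-< = pos-<′
    ; linked = carry-linked linked (all-maximal I k≤n smaller-on-p) step
    ; layout = layout-move layout 1≤k k≤n legal }
    where
      open EvenInv I
      ch : Chosen n pos (pos 1) k
      ch = chosen-in-round layout 1≤n pos-< eq
      open Chosen ch
      1<k : 1 < k
      1<k = ≤∧≢⇒< 1≤k (λ 1≡k → not-on-p (cong pos (sym 1≡k)))
      t = target k (pegOf s P k)
      step : Step (isOdd k) (pos k) t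
      step = subst (λ c → Step (isOdd k) c t) (pegOf-layout layout 1≤k k≤n (pos-< k 1≤k k≤n))
        (target-step k (pegOf s P k))
      below = link-below-chosen I 1<k k≤n smaller-on-p
      uk<m = digit-< I ≤-refl k 1≤k k≤n
      room : u k < m₁
      room = ≤∧≢⇒< (≤-pred uk<m) λ uk≡m₁ →
        not-on-p (sym (≡ₘ-small (pos-< 1 ≤-refl 1≤n) (pos-< k 1≤k k≤n)
          (link-same-digit (link-cong refl refl uk≡m₁ refl below))))
      legal : ∀ d → 1 ≤ d → d < k → pos d ≢ t
      legal d 1≤d d<k pd≡t = link-blocked below uk<m step (trans (sym (smaller-on-p d 1≤d d<k)) pd≡t)
      u-<′ : ∀ d → 2 ≤ d → d ≤ n → carry-digits u k d < m
      u-<′ d 2≤d d≤n with <-cmp d k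
      ... | tri< d<k _ _   = subst (_< m) (sym (carry-below u k d<k)) (s≤s z≤n)
      ... | tri≈ _ refl _  = subst (_< m) (sym (carry-at u d)) (s≤s room)
      ... | tri> d≮k d≢k _ = subst (_< m) (sym (carry-above u k d≮k d≢k)) (u-< d 2≤d d≤n)
      pos-<′ : ∀ d → 1 ≤ d → d ≤ n → upd pos k t d < P
      pos-<′ d 1≤d d≤n with d ≟ k
      ... | yes refl = subst (_< P) (sym (upd-same pos d t)) (target-< d (pegOf s P d))
      ... | no d≢k   = subst (_< P) (sym (upd-other pos k t d≢k)) (pos-< d 1≤d d≤n)

  even-run : GoodRun (initStacks n) (evenRound m)
  even-run = goodRun-cong (evenRound-shape m)
    (twoPhase-good (λ s → s) P m₁ (λ _ → evenStep m 1) (evenStep m) (EvenInv 0) (EvenInv m₁)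
      even-tour even-carry (initStacks n) even-start)

odd-run-empty : ∀ m → GoodRun (oddInit 0) (oddRound m)
odd-run-empty m = goodRun-cong (oddRound-shape m)
  (twoPhase-onlyDisk1 proj₁ m (m ∸ 1) _ (oddStep m) (λ _ _ → onlyDisk1-move _) (λ _ → onlyDisk1-move _)
    (oddInit 0) onlyDisk1-init)

even-run-empty : ∀ m → GoodRun (initStacks 0) (evenRound m)
even-run-empty m = goodRun-cong (evenRound-shape m)
  (twoPhase-onlyDisk1 (λ s → s) (suc m) (m ∸ 1) _ (evenStep m) (λ _ _ → onlyDisk1-move _)
    (λ _ → onlyDisk1-move _) (initStacks 0) onlyDisk1-init)

comp-run-empty : ∀ m → GoodRun (compInit 0) (compRound m)
comp-run-empty m = goodRun-cong (compRound-shape m)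
  (twoPhase-onlyDisk1 proj₁ 3 (m ∸ 1) _ (turn m) (λ _ → turned) turned (compInit 0) onlyDisk1-init)
  where
    turned : ∀ y → OnlyDisk1 (proj₁ y) → OnlyDisk1 (proj₁ (turn m 1 y))
    turned (s , dial) only with pegOf s 3 1 ≡ᵇ dialPeg m (dialNext m (dial 1))
    ... | true  = only
    ... | false = onlyDisk1-move _ only

lemma1 :
    (∀ (m n : ℕ) → (∃ λ j → m ≡ suc (2 * j)) → 3 ≤ m →
       GoodRun (oddInit n) (oddRound m))
    × (∀ (m n : ℕ) → (∃ λ j → m ≡ 2 * j) → 2 ≤ m →
       GoodRun (initStacks n) (evenRound m))
    × (∀ (m n : ℕ) → (∃ λ j → m ≡ suc (2 * j)) → 3 ≤ m →
       GoodRun (compInit n) (compRound m))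
lemma1 = odd-good , even-good , comp-good
  where
    odd-good : ∀ m n → (∃ λ j → m ≡ suc (2 * j)) → 3 ≤ m → GoodRun (oddInit n) (oddRound m)
    odd-good _ zero    (j , refl) _          = odd-run-empty _
    odd-good _ (suc n) (j , refl) (s≤s 2≤2j) =
      OddAlgorithm.odd-run (2 * j) (odd-double j) (≤-trans (s≤s z≤n) 2≤2j) (suc n) (s≤s z≤n)

    even-good : ∀ m n → (∃ λ j → m ≡ 2 * j) → 2 ≤ m → GoodRun (initStacks n) (evenRound m)
    even-good (suc m₁) zero    _ _ = even-run-empty _
    even-good (suc m₁) (suc n) _ _ = EvenAlgorithm.even-run m₁ (suc n) (s≤s z≤n)

    comp-good : ∀ m n → (∃ λ j → m ≡ suc (2 * j)) → 3 ≤ m → GoodRun (compInit n) (compRound m)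
    comp-good _ zero    (j , refl) _          = comp-run-empty _
    comp-good _ (suc n) (j , refl) (s≤s 2≤2j) =
      CompressedAlgorithm.comp-run (2 * j) (odd-double j) (≤-trans (s≤s z≤n) 2≤2j) (suc n) (s≤s z≤n)
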